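{- Let $A_1A_2A_3A_4$ be a fundamental tetrahedron (with vertices in $\widehat{\mathbb{Q}}(\sigma)$), let $X\in\widehat{\mathbb{Q}}(\sigma)$ be distinct from $A_1,\dots,A_4$, and let $l_i=l(X,A_i)$ be the det-length, $i=1,\dots,4$. Then $$\sum_{i=1}^4 l_i^4=\sum_{1\le i<j\le4}l_i^2l_j^2.$$
   Context: Let $\sigma=e^{i\pi/3}=\frac{1+i\sqrt3}{2}$, $\mathbb{Z}[\sigma]$ the Eisenstein integers, $\mathbb{Q}(\sigma)$ its fraction field, $\widehat{\mathbb{Q}}(\sigma)=\mathbb{Q}(\sigma)\cup\{\infty\}$. In the upper half-space model of $\mathbb{H}^3$ (boundary $\widehat{\mathbb{C}}$), let $T$ be the regular ideal tetrahedron with vertices $0,1,\sigma,\infty$ and $H$ the group generated by reflections in the faces of $T$; the images $hT$, $h\in H$, are the fundamental tetrahedra, which tile $\mathbb{H}^3$ with vertex set $\widehat{\mathbb{Q}}(\sigma)$. A fraction $p/q$ ($p,q\in\mathbb{Z}[\sigma]$, not both zero, $p/0=\infty$) is irreducible if every common factor $k\in\mathbb{Z}[\sigma]$ of $p,q$ has $|k|=1$; each point of $\widehat{\mathbb{Q}}(\sigma)$ has an irreducible representation, unique up to a common unit factor. For points represented by irreducible fractions $p_1/q_1$, $p_2/q_2$, the det-length is $l(p_1/q_1,p_2/q_2)=|p_1q_2-p_2q_1|$. -}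

module Defs where

open import Data.Integer using (ℤ; +_; -_; _+_; _-_; _*_)
open import Data.Fin using (Fin; zero; suc)
open import Data.List using (List; []; _∷_)
open import Data.Product using (Σ; ∃; _×_; _,_; proj₁; proj₂)
open import Relation.Binary.PropositionalEquality using (_≡_)
open import Relation.Nullary using (¬_)

-- Eisenstein integers a + b σ, with σ = e^{iπ/3}, σ² = σ - 1.
record ℤσ : Set where
  constructor ⟨_,_⟩
  field
    re : ℤ
    sg : ℤ
open ℤσ public

0σ 1σ σσ : ℤσ
0σ = ⟨ + 0 , + 0 ⟩
1σ = ⟨ + 1 , + 0 ⟩
σσ = ⟨ + 0 , + 1 ⟩

infixl 6 _+σ_ _-σ_
infixl 7 _*σ_

_+σ_ : ℤσ → ℤσ → ℤσ
⟨ a , b ⟩ +σ ⟨ c , d ⟩ = ⟨ a + c , b + d ⟩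

_-σ_ : ℤσ → ℤσ → ℤσ
⟨ a , b ⟩ -σ ⟨ c , d ⟩ = ⟨ a - c , b - d ⟩

_*σ_ : ℤσ → ℤσ → ℤσ
⟨ a , b ⟩ *σ ⟨ c , d ⟩ = ⟨ a * c - b * d , a * d + b * c + b * d ⟩

-- complex conjugation: conj(σ) = 1 - σ
conj : ℤσ → ℤσ
conj ⟨ a , b ⟩ = ⟨ a + b , - b ⟩

normSq : ℤσ → ℤ
normSq ⟨ a , b ⟩ = a * a + a * b + b * b

_∣σ_ : ℤσ → ℤσ → Set
k ∣σ p = ∃ λ m → p ≡ k *σ m

-- a fraction p/q is a pair (p , q); p/0 = ∞
Frac : Set
Frac = ℤσ × ℤσ

Irreducible : Frac → Set
Irreducible (p , q) =
  ¬ (p ≡ 0σ × q ≡ 0σ) × (∀ k → k ∣σ p → k ∣σ q → normSq k ≡ + 1)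

SamePoint : Frac → Frac → Set
SamePoint (p₁ , q₁) (p₂ , q₂) = p₁ *σ q₂ ≡ p₂ *σ q₁

detLenSq : Frac → Frac → ℤ
detLenSq (p₁ , q₁) (p₂ , q₂) = normSq (p₁ *σ q₂ -σ p₂ *σ q₁)

-- anti-Möbius map z ↦ (a z̄ + b)/(c z̄ + d) acting on fractions
antiMob : ℤσ → ℤσ → ℤσ → ℤσ → Frac → Frac
antiMob a b c d (p , q) = (a *σ conj p +σ b *σ conj q , c *σ conj p +σ d *σ conj q)

-- the reflections in the four faces of T = (0, 1, σ, ∞):
--  zero  : plane over the line through 0,1      z ↦ z̄
--  suc 0 : plane over the line through 0,σ      z ↦ σ² z̄          (σ² = σ - 1)
--  suc 1 : plane over the line through 1,σ      z ↦ -σ z̄ + 1 + σ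
--  suc 2 : hemisphere through 0,1,σ             z ↦ (1-σ) z̄ / ((1-2σ) z̄ + σ)
--  (all matrices have unit determinant)
reflect : Fin 4 → Frac → Frac
reflect zero                   = antiMob 1σ 0σ 0σ 1σ
reflect (suc zero)             = antiMob ⟨ -[1] , + 1 ⟩ 0σ 0σ 1σ
  where -[1] = - (+ 1)
reflect (suc (suc zero))       = antiMob ⟨ + 0 , - (+ 1) ⟩ ⟨ + 1 , + 1 ⟩ 0σ 1σ
reflect (suc (suc (suc zero))) = antiMob ⟨ + 1 , - (+ 1) ⟩ 0σ ⟨ + 1 , - (+ 2) ⟩ σσ

-- an element of H, given as a word in the generating reflections
-- (h = r_{w₁} ∘ r_{w₂} ∘ … ), acting on fractions
actH : List (Fin 4) → Frac → Frac
actH []      x = x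
actH (r ∷ w) x = reflect r (actH w x)

vertexT : Fin 4 → Frac
vertexT zero                   = (0σ , 1σ)
vertexT (suc zero)             = (1σ , 1σ)
vertexT (suc (suc zero))       = (σσ , 1σ)
vertexT (suc (suc (suc zero))) = (1σ , 0σ)

IsFundamentalTetrahedron : (Fin 4 → Frac) → Set
IsFundamentalTetrahedron A =
  Σ (List (Fin 4)) λ w → ∀ i → SamePoint (A i) (actH w (vertexT i))

-- Each generating reflection acts on fractions as W ↦ M W̄ with M a matrix over ℤ[σ] of unit
-- determinant. Since det(X, M W) = det(adj(M) X, W) and det(X, W̄) = conj det(X̄, W), for every
-- h ∈ H and X there is one point Z with l(X, hV) = l(Z, V) for all V. So the det-lengths from X
-- to the vertices of hT are those from Z to 0, 1, σ, ∞, and for these the relation is a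
-- polynomial identity in the coordinates of Z. The vertices of hT are unimodular pairs, being
-- images of unimodular pairs under unimodular maps, so the irreducible Aᵢ are unit multiples of
-- them and have the same det-lengths.
{-# OPTIONS --safe #-}
module Submission where

open import Defs
open import Algebra.Bundles using (CommutativeRing)
import Algebra.Consequences.Propositional as Consequences
open import Data.Fin using (Fin; zero; suc)
open import Data.Integer using (ℤ; +_; -_; _+_; _*_)
import Data.Integer.Properties as ℤ
open import Data.List using (_∷_; [])
open import Data.Maybe using (just; nothing)
open import Data.Product using (∃; _×_; _,_; proj₁; proj₂)
open import Function using (_∘_)
open import Level using (0ℓ)
open import Relation.Binary.PropositionalEquality
open import Relation.Nullary using (¬_)
open import Tactic.RingSolver using (solve-∀; solve)
open import Tactic.RingSolver.Core.AlmostCommutativeRing using (AlmostCommutativeRing; fromCommutativeRing)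

TetrahedronRelation : ℤ → ℤ → ℤ → ℤ → Set
TetrahedronRelation n₁ n₂ n₃ n₄ =
  n₁ * n₁ + n₂ * n₂ + n₃ * n₃ + n₄ * n₄ ≡ n₁ * n₂ + n₁ * n₃ + n₁ * n₄ + n₂ * n₃ + n₂ * n₄ + n₃ * n₄

TetrahedronRelation-cong : ∀ {m₁ m₂ m₃ m₄ n₁ n₂ n₃ n₄} → m₁ ≡ n₁ → m₂ ≡ n₂ → m₃ ≡ n₃ → m₄ ≡ n₄ →
                           TetrahedronRelation n₁ n₂ n₃ n₄ → TetrahedronRelation m₁ m₂ m₃ m₄
TetrahedronRelation-cong refl refl refl refl relation = relation

-- The integer ring solver does not look inside ℤσ operations, so identities between nested
-- ones are restated in coordinates.
module ℤσ-Properties where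
  open import Algebra.Definitions {A = ℤσ} _≡_
  open import Data.Integer using (_-_)
  import Data.Integer.Tactic.RingSolver as ℤ-Solver

  negσ : ℤσ → ℤσ
  negσ ⟨ a , b ⟩ = ⟨ - a , - b ⟩

  +σ-assoc : Associative _+σ_
  +σ-assoc ⟨ a , b ⟩ ⟨ c , d ⟩ ⟨ e , f ⟩ = cong₂ ⟨_,_⟩ (ℤ.+-assoc a c e) (ℤ.+-assoc b d f)

  +σ-comm : Commutative _+σ_
  +σ-comm ⟨ a , b ⟩ ⟨ c , d ⟩ = cong₂ ⟨_,_⟩ (ℤ.+-comm a c) (ℤ.+-comm b d)

  +σ-identityˡ : LeftIdentity 0σ _+σ_
  +σ-identityˡ ⟨ a , b ⟩ = cong₂ ⟨_,_⟩ (ℤ.+-identityˡ a) (ℤ.+-identityˡ b)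

  negσ-inverseˡ : LeftInverse 0σ negσ _+σ_
  negσ-inverseˡ ⟨ a , b ⟩ = cong₂ ⟨_,_⟩ (ℤ.+-inverseˡ a) (ℤ.+-inverseˡ b)

  *σ-comm : Commutative _*σ_
  *σ-comm ⟨ a , b ⟩ ⟨ c , d ⟩ =
    cong₂ ⟨_,_⟩ (ℤ-Solver.solve (a ∷ b ∷ c ∷ d ∷ [])) (ℤ-Solver.solve (a ∷ b ∷ c ∷ d ∷ []))

  *σ-identityˡ : LeftIdentity 1σ _*σ_
  *σ-identityˡ ⟨ a , b ⟩ = cong₂ ⟨_,_⟩ (ℤ-Solver.solve (a ∷ b ∷ [])) (ℤ-Solver.solve (a ∷ b ∷ []))

  *σ-assoc : Associative _*σ_
  *σ-assoc ⟨ a , b ⟩ ⟨ c , d ⟩ ⟨ e , f ⟩ = cong₂ ⟨_,_⟩ (re-assoc a b c d e f) (sg-assoc a b c d e f)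
    where
    re-assoc : ∀ a b c d e f →
      (a * c - b * d) * e - (a * d + b * c + b * d) * f ≡ a * (c * e - d * f) - b * (c * f + d * e + d * f)
    re-assoc = ℤ-Solver.solve-∀
    sg-assoc : ∀ a b c d e f →
      (a * c - b * d) * f + (a * d + b * c + b * d) * e + (a * d + b * c + b * d) * f
      ≡ a * (c * f + d * e + d * f) + b * (c * e - d * f) + b * (c * f + d * e + d * f)
    sg-assoc = ℤ-Solver.solve-∀

  *σ-distribʳ : _*σ_ DistributesOverʳ _+σ_
  *σ-distribʳ ⟨ a , b ⟩ ⟨ c , d ⟩ ⟨ e , f ⟩ = cong₂ ⟨_,_⟩ (re-distrib a b c d e f) (sg-distrib a b c d e f)
    where
    re-distrib : ∀ a b c d e f → (c + e) * a - (d + f) * b ≡ (c * a - d * b) + (e * a - f * b)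
    re-distrib = ℤ-Solver.solve-∀
    sg-distrib : ∀ a b c d e f →
      (c + e) * b + (d + f) * a + (d + f) * b ≡ (c * b + d * a + d * b) + (e * b + f * a + f * b)
    sg-distrib = ℤ-Solver.solve-∀

  ℤσ-commutativeRing : CommutativeRing 0ℓ 0ℓ
  ℤσ-commutativeRing = record
    { Carrier = ℤσ ; _≈_ = _≡_ ; _+_ = _+σ_ ; _*_ = _*σ_ ; -_ = negσ ; 0# = 0σ ; 1# = 1σ
    ; isCommutativeRing = record
      { isRing = record
        { +-isAbelianGroup = record
          { isGroup = record
            { isMonoid = record
              { isSemigroup = record
                { isMagma = record { isEquivalence = isEquivalence ; ∙-cong = cong₂ _+σ_ }
                ; assoc = +σ-assoc }
              ; identity = Consequences.comm∧idˡ⇒id +σ-comm +σ-identityˡ }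
            ; inverse = Consequences.comm∧invˡ⇒inv +σ-comm negσ-inverseˡ
            ; ⁻¹-cong = cong negσ }
          ; comm = +σ-comm }
        ; *-cong = cong₂ _*σ_
        ; *-assoc = *σ-assoc
        ; *-identity = Consequences.comm∧idˡ⇒id *σ-comm *σ-identityˡ
        ; distrib = Consequences.comm∧distrʳ⇒distr (cong₂ _+σ_) *σ-comm *σ-distribʳ }
      ; *-comm = *σ-comm } }

  ℤσ-ring : AlmostCommutativeRing 0ℓ 0ℓ
  ℤσ-ring = fromCommutativeRing ℤσ-commutativeRing λ { ⟨ + 0 , + 0 ⟩ → just refl ; _ → nothing }

  conj-+σ : ∀ x y → conj (x +σ y) ≡ conj x +σ conj y
  conj-+σ ⟨ a , b ⟩ ⟨ c , d ⟩ = cong₂ ⟨_,_⟩ (re-conj a b c d) (ℤ.neg-distrib-+ b d)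
    where
    re-conj : ∀ a b c d → (a + c) + (b + d) ≡ (a + b) + (c + d)
    re-conj = ℤ-Solver.solve-∀

  conj-negσ : ∀ x → conj (negσ x) ≡ negσ (conj x)
  conj-negσ ⟨ a , b ⟩ = cong₂ ⟨_,_⟩ (sym (ℤ.neg-distrib-+ a b)) refl

  conj--σ : ∀ x y → conj (x -σ y) ≡ conj x -σ conj y
  conj--σ x y = trans (conj-+σ x (negσ y)) (cong (conj x +σ_) (conj-negσ y))

  conj-*σ : ∀ x y → conj (x *σ y) ≡ conj x *σ conj y
  conj-*σ ⟨ a , b ⟩ ⟨ c , d ⟩ = cong₂ ⟨_,_⟩ (re-conj a b c d) (sg-conj a b c d)
    where
    re-conj : ∀ a b c d →
      (a * c - b * d) + (a * d + b * c + b * d) ≡ (a + b) * (c + d) - (- b) * (- d)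
    re-conj = ℤ-Solver.solve-∀
    sg-conj : ∀ a b c d →
      - (a * d + b * c + b * d) ≡ (a + b) * (- d) + (- b) * (c + d) + (- b) * (- d)
    sg-conj = ℤ-Solver.solve-∀

  conj-involutive : ∀ x → conj (conj x) ≡ x
  conj-involutive ⟨ a , b ⟩ = cong₂ ⟨_,_⟩ (re-conj a b) (ℤ.neg-involutive b)
    where
    re-conj : ∀ a b → (a + b) + - b ≡ a
    re-conj = ℤ-Solver.solve-∀

  normSq-*σ : ∀ x y → normSq (x *σ y) ≡ normSq x * normSq y
  normSq-*σ ⟨ a , b ⟩ ⟨ c , d ⟩ = in-coordinates a b c d
    where
    in-coordinates : ∀ a b c d →
      (a * c - b * d) * (a * c - b * d) + (a * c - b * d) * (a * d + b * c + b * d)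
        + (a * d + b * c + b * d) * (a * d + b * c + b * d)
      ≡ (a * a + a * b + b * b) * (c * c + c * d + d * d)
    in-coordinates = ℤ-Solver.solve-∀

  normSq-conj : ∀ x → normSq (conj x) ≡ normSq x
  normSq-conj ⟨ a , b ⟩ = in-coordinates a b
    where
    in-coordinates : ∀ a b → (a + b) * (a + b) + (a + b) * (- b) + (- b) * (- b) ≡ a * a + a * b + b * b
    in-coordinates = ℤ-Solver.solve-∀

  σσ-*σ : ∀ c d → σσ *σ ⟨ c , d ⟩ ≡ ⟨ - d , c + d ⟩
  σσ-*σ c d = cong₂ ⟨_,_⟩ (ℤ-Solver.solve (c ∷ d ∷ [])) (ℤ-Solver.solve (c ∷ d ∷ []))

  -- n₁, …, n₄ are the norms of p, p - q, p - σq and -q for p = a + bσ, q = c + dσ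
  normSq-tetrahedron-identity : ∀ a b c d →
    let N  = λ x y → x * x + x * y + y * y
        n₁ = N a b
        n₂ = N (a - c) (b - d)
        n₃ = N (a - - d) (b - (c + d))
        n₄ = N (- c) (- d)
    in n₁ * n₁ + n₂ * n₂ + n₃ * n₃ + n₄ * n₄ ≡ n₁ * n₂ + n₁ * n₃ + n₁ * n₄ + n₂ * n₃ + n₂ * n₄ + n₃ * n₄
  normSq-tetrahedron-identity = ℤ-Solver.solve-∀

open ℤσ-Properties

-- x -σ y is definitionally x +σ negσ y, and only the latter is recognised by the ring solver,
-- so the identities it proves are stated in that form.
vertexT-tetrahedronRelation : ∀ Z → let n = λ i → detLenSq Z (vertexT i) in
  TetrahedronRelation (n zero) (n (suc zero)) (n (suc (suc zero))) (n (suc (suc (suc zero))))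
vertexT-tetrahedronRelation (p@(⟨ a , b ⟩) , q@(⟨ c , d ⟩)) =
  TetrahedronRelation-cong
    (cong normSq (det-0 p q))
    (cong normSq (det-1 p q))
    (cong normSq (trans (det-σ p q) (cong (λ s → p +σ negσ s) (σσ-*σ c d))))
    (cong normSq (det-∞ p q))
    (normSq-tetrahedron-identity a b c d)
  where
  det-0 : ∀ p q → p *σ 1σ +σ negσ (0σ *σ q) ≡ p
  det-0 = solve-∀ ℤσ-ring
  det-1 : ∀ p q → p *σ 1σ +σ negσ (1σ *σ q) ≡ p +σ negσ q
  det-1 = solve-∀ ℤσ-ring
  det-σ : ∀ p q → p *σ 1σ +σ negσ (σσ *σ q) ≡ p +σ negσ (σσ *σ q)
  det-σ = solve-∀ ℤσ-ring
  det-∞ : ∀ p q → p *σ 0σ +σ negσ (1σ *σ q) ≡ negσ q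
  det-∞ = solve-∀ ℤσ-ring

HasDetLenSqDual : (Frac → Frac) → Set
HasDetLenSqDual f = ∀ X → ∃ λ Z → ∀ W → detLenSq X (f W) ≡ detLenSq Z W

detLenSq-adjugate : ∀ a b c d x y P Q →
  detLenSq (x , y) (a *σ P +σ b *σ Q , c *σ P +σ d *σ Q)
  ≡ detLenSq (d *σ x -σ b *σ y , a *σ y -σ c *σ x) (P , Q)
detLenSq-adjugate a b c d x y P Q = cong normSq (adjugate a b c d x y P Q)
  where
  adjugate : ∀ a b c d x y P Q →
    x *σ (c *σ P +σ d *σ Q) +σ negσ ((a *σ P +σ b *σ Q) *σ y)
    ≡ (d *σ x +σ negσ (b *σ y)) *σ Q +σ negσ (P *σ (a *σ y +σ negσ (c *σ x)))
  adjugate = solve-∀ ℤσ-ring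

detLenSq-conj : ∀ x y p q → detLenSq (x , y) (conj p , conj q) ≡ detLenSq (conj x , conj y) (p , q)
detLenSq-conj x y p q = trans (cong normSq (sym conj-det)) (normSq-conj (conj x *σ q -σ p *σ conj y))
  where
  open ≡-Reasoning
  conj-det : conj (conj x *σ q -σ p *σ conj y) ≡ x *σ conj q -σ conj p *σ y
  conj-det = begin
    conj (conj x *σ q -σ p *σ conj y)                    ≡⟨ conj--σ (conj x *σ q) (p *σ conj y) ⟩
    conj (conj x *σ q) -σ conj (p *σ conj y)             ≡⟨ cong₂ _-σ_ (conj-*σ (conj x) q) (conj-*σ p (conj y)) ⟩
    conj (conj x) *σ conj q -σ conj p *σ conj (conj y)   ≡⟨ cong₂ (λ s t → s *σ conj q -σ conj p *σ t)
                                                                  (conj-involutive x) (conj-involutive y) ⟩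
    x *σ conj q -σ conj p *σ y                           ∎

antiMob-dual : ∀ a b c d → HasDetLenSqDual (antiMob a b c d)
antiMob-dual a b c d (x , y) =
  (conj (d *σ x -σ b *σ y) , conj (a *σ y -σ c *σ x)) ,
  λ { (p , q) → trans (detLenSq-adjugate a b c d x y (conj p) (conj q))
                      (detLenSq-conj (d *σ x -σ b *σ y) (a *σ y -σ c *σ x) p q) }

Unimodular : Frac → Set
Unimodular (p , q) = ∃ λ u → ∃ λ v → u *σ p +σ v *σ q ≡ 1σ

vertexT-unimodular : ∀ i → Unimodular (vertexT i)
vertexT-unimodular zero                   = 0σ , 1σ , refl
vertexT-unimodular (suc zero)             = 1σ , 0σ , refl
vertexT-unimodular (suc (suc zero))       = 0σ , 1σ , refl
vertexT-unimodular (suc (suc (suc zero))) = 1σ , 0σ , refl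

-- From u p + v q = 1, conjugation gives ū p̄ + v̄ q̄ = 1, and the adjugate of the matrix, divided
-- by its determinant, carries this Bézout relation to the image.
antiMob-unimodular : ∀ a b c d e → (a *σ d -σ b *σ c) *σ e ≡ 1σ →
                     ∀ {W} → Unimodular W → Unimodular (antiMob a b c d W)
antiMob-unimodular a b c d e det*e≡1 {p , q} (u , v , bezout) =
  e *σ (conj u *σ d -σ conj v *σ c) , e *σ (conj v *σ a -σ conj u *σ b) ,
  (begin
    _ ≡⟨ adjugate-bezout a b c d e (conj u) (conj v) (conj p) (conj q) ⟩
    ((a *σ d -σ b *σ c) *σ e) *σ (conj u *σ conj p +σ conj v *σ conj q)
      ≡⟨ cong (((a *σ d -σ b *σ c) *σ e) *σ_) conj-bezout ⟨
    ((a *σ d -σ b *σ c) *σ e) *σ conj (u *σ p +σ v *σ q)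
      ≡⟨ cong₂ (λ s t → s *σ conj t) det*e≡1 bezout ⟩
    1σ ∎)
  where
  open ≡-Reasoning
  adjugate-bezout : ∀ a b c d e u v p q →
    (e *σ (u *σ d +σ negσ (v *σ c))) *σ (a *σ p +σ b *σ q) +σ (e *σ (v *σ a +σ negσ (u *σ b))) *σ (c *σ p +σ d *σ q)
    ≡ ((a *σ d +σ negσ (b *σ c)) *σ e) *σ (u *σ p +σ v *σ q)
  adjugate-bezout = solve-∀ ℤσ-ring
  conj-bezout : conj (u *σ p +σ v *σ q) ≡ conj u *σ conj p +σ conj v *σ conj q
  conj-bezout = trans (conj-+σ (u *σ p) (v *σ q)) (cong₂ _+σ_ (conj-*σ u p) (conj-*σ v q))

record UnitDetAntiMob (f : Frac → Frac) : Set where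
  field
    a b c d e : ℤσ
    det*e≡1   : (a *σ d -σ b *σ c) *σ e ≡ 1σ
    f≗antiMob : ∀ W → f W ≡ antiMob a b c d W

unitDetAntiMob-dual : ∀ {f} → UnitDetAntiMob f → HasDetLenSqDual f
unitDetAntiMob-dual m X =
  proj₁ (antiMob-dual a b c d X) ,
  λ W → trans (cong (detLenSq X) (f≗antiMob W)) (proj₂ (antiMob-dual a b c d X) W)
  where open UnitDetAntiMob m

unitDetAntiMob-unimodular : ∀ {f} → UnitDetAntiMob f → ∀ {W} → Unimodular W → Unimodular (f W)
unitDetAntiMob-unimodular m {W} unimodular =
  subst Unimodular (sym (f≗antiMob W)) (antiMob-unimodular a b c d e det*e≡1 unimodular)
  where open UnitDetAntiMob m

reflect-unitDetAntiMob : ∀ r → UnitDetAntiMob (reflect r)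
reflect-unitDetAntiMob zero =
  record { a = 1σ ; b = 0σ ; c = 0σ ; d = 1σ ; e = 1σ
         ; det*e≡1 = refl ; f≗antiMob = λ _ → refl }
reflect-unitDetAntiMob (suc zero) =
  record { a = ⟨ - (+ 1) , + 1 ⟩ ; b = 0σ ; c = 0σ ; d = 1σ ; e = ⟨ + 0 , - (+ 1) ⟩
         ; det*e≡1 = refl ; f≗antiMob = λ _ → refl }
reflect-unitDetAntiMob (suc (suc zero)) =
  record { a = ⟨ + 0 , - (+ 1) ⟩ ; b = ⟨ + 1 , + 1 ⟩ ; c = 0σ ; d = 1σ ; e = ⟨ - (+ 1) , + 1 ⟩
         ; det*e≡1 = refl ; f≗antiMob = λ _ → refl }
reflect-unitDetAntiMob (suc (suc (suc zero))) =
  record { a = ⟨ + 1 , - (+ 1) ⟩ ; b = 0σ ; c = ⟨ + 1 , - (+ 2) ⟩ ; d = σσ ; e = 1σ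
         ; det*e≡1 = refl ; f≗antiMob = λ _ → refl }

∘-dual : ∀ {f g} → HasDetLenSqDual f → HasDetLenSqDual g → HasDetLenSqDual (f ∘ g)
∘-dual {g = g} f-dual g-dual X =
  proj₁ (g-dual Y) , λ W → trans (proj₂ (f-dual X) (g W)) (proj₂ (g-dual Y) W)
  where
  Y : Frac
  Y = proj₁ (f-dual X)

actH-dual : ∀ w → HasDetLenSqDual (actH w)
actH-dual []      X = X , λ _ → refl
actH-dual (r ∷ w)   =
  ∘-dual {reflect r} {actH w} (unitDetAntiMob-dual (reflect-unitDetAntiMob r)) (actH-dual w)

actH-unimodular : ∀ w {W} → Unimodular W → Unimodular (actH w W)
actH-unimodular []      unimodular = unimodular
actH-unimodular (r ∷ w) unimodular =
  unitDetAntiMob-unimodular (reflect-unitDetAntiMob r) (actH-unimodular w unimodular)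

multiple-of-unimodular : ∀ {p q r s} → Unimodular (r , s) → SamePoint (p , q) (r , s) →
                         ∃ λ k → p ≡ k *σ r × q ≡ k *σ s
multiple-of-unimodular {p} {q} {r} {s} (u , v , bezout) same = u *σ p +σ v *σ q , p≡kr , q≡ks
  where
  open ≡-Reasoning
  p≡kr : p ≡ (u *σ p +σ v *σ q) *σ r
  p≡kr = begin
    p                               ≡⟨ solve (p ∷ []) ℤσ-ring ⟩
    p *σ 1σ                         ≡⟨ cong (p *σ_) bezout ⟨
    p *σ (u *σ r +σ v *σ s)         ≡⟨ solve (p ∷ r ∷ s ∷ u ∷ v ∷ []) ℤσ-ring ⟩
    (u *σ p) *σ r +σ v *σ (p *σ s)  ≡⟨ cong (λ t → (u *σ p) *σ r +σ v *σ t) same ⟩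
    (u *σ p) *σ r +σ v *σ (r *σ q)  ≡⟨ solve (p ∷ q ∷ r ∷ u ∷ v ∷ []) ℤσ-ring ⟩
    (u *σ p +σ v *σ q) *σ r         ∎
  q≡ks : q ≡ (u *σ p +σ v *σ q) *σ s
  q≡ks = begin
    q                               ≡⟨ solve (q ∷ []) ℤσ-ring ⟩
    q *σ 1σ                         ≡⟨ cong (q *σ_) bezout ⟨
    q *σ (u *σ r +σ v *σ s)         ≡⟨ solve (q ∷ r ∷ s ∷ u ∷ v ∷ []) ℤσ-ring ⟩
    u *σ (r *σ q) +σ (v *σ q) *σ s  ≡⟨ cong (λ t → u *σ t +σ (v *σ q) *σ s) same ⟨
    u *σ (p *σ s) +σ (v *σ q) *σ s  ≡⟨ solve (p ∷ q ∷ s ∷ u ∷ v ∷ []) ℤσ-ring ⟩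
    (u *σ p +σ v *σ q) *σ s         ∎

detLenSq-scaleʳ : ∀ X k r s → detLenSq X (k *σ r , k *σ s) ≡ normSq k * detLenSq X (r , s)
detLenSq-scaleʳ (x , y) k r s = trans (cong normSq (factor x y k r s)) (normSq-*σ k (x *σ s -σ r *σ y))
  where
  factor : ∀ x y k r s → x *σ (k *σ s) +σ negσ ((k *σ r) *σ y) ≡ k *σ (x *σ s +σ negσ (r *σ y))
  factor = solve-∀ ℤσ-ring

detLenSq-samePoint : ∀ {A B} → Irreducible A → Unimodular B → SamePoint A B →
                     ∀ X → detLenSq X A ≡ detLenSq X B
detLenSq-samePoint {p , q} {r , s} (_ , common-factor-unit) unimodular same X =
  let k , p≡kr , q≡ks = multiple-of-unimodular unimodular same in
  begin
    detLenSq X (p , q)             ≡⟨ cong₂ (λ p q → detLenSq X (p , q)) p≡kr q≡ks ⟩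
    detLenSq X (k *σ r , k *σ s)   ≡⟨ detLenSq-scaleʳ X k r s ⟩
    normSq k * detLenSq X (r , s)  ≡⟨ cong (_* detLenSq X (r , s))
                                           (common-factor-unit k (r , p≡kr) (s , q≡ks)) ⟩
    + 1 * detLenSq X (r , s)       ≡⟨ ℤ.*-identityˡ (detLenSq X (r , s)) ⟩
    detLenSq X (r , s)             ∎
  where open ≡-Reasoning

theorem4p8 : (A : Fin 4 → Frac) → (∀ i → Irreducible (A i)) → IsFundamentalTetrahedron A →
    (X : Frac) → Irreducible X → (∀ i → ¬ SamePoint X (A i)) →
    let n₁ = detLenSq X (A zero)
        n₂ = detLenSq X (A (suc zero))
        n₃ = detLenSq X (A (suc (suc zero)))
        n₄ = detLenSq X (A (suc (suc (suc zero))))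
    in n₁ * n₁ + n₂ * n₂ + n₃ * n₃ + n₄ * n₄
       ≡ n₁ * n₂ + n₁ * n₃ + n₁ * n₄ + n₂ * n₃ + n₂ * n₄ + n₃ * n₄
theorem4p8 A irreducible (w , sameVertex) X _ _ =
  TetrahedronRelation-cong (lengths zero) (lengths (suc zero)) (lengths (suc (suc zero)))
                           (lengths (suc (suc (suc zero)))) (vertexT-tetrahedronRelation Z)
  where
  Z : Frac
  Z = proj₁ (actH-dual w X)
  lengths : ∀ i → detLenSq X (A i) ≡ detLenSq Z (vertexT i)
  lengths i =
    trans (detLenSq-samePoint (irreducible i) (actH-unimodular w (vertexT-unimodular i)) (sameVertex i) X)
          (proj₂ (actH-dual w X) (vertexT i))
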